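{- Fix $m\in\mathbb{Z}^+$ and $r\in\mathbb{N}$. Let $X$ be a finite set and $\mathsf{st}\colon X\to\mathbb{N}$ a function. Suppose that for every $l\in\{0,1,\dots,m-1\}$ and every $0\le j\le r-1$, $$\sum_{x\in X,\ \mathsf{st}(x)\equiv l \ (\mathrm{mod}\ 2m)}\binom{\mathsf{st}(x)}{j}=\sum_{x\in X,\ \mathsf{st}(x)\equiv l+m\ (\mathrm{mod}\ 2m)}\binom{\mathsf{st}(x)}{j}.$$ Then $\sum_{x\in X}q^{\mathsf{st}(x)}\in(1+q^m)^r\mathbb{Z}[q]$. -}

module Defs where

open import Data.Nat as ℕ using (ℕ; zero; suc; NonZero; _%_; _≟_)
open import Data.Nat.Properties using (m*n≢0)
open import Data.Nat.Combinatorics using (_C_)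
open import Data.Integer as ℤ using (ℤ; +_)
open import Data.List using (List; []; _∷_; map; replicate; _++_; foldr)
open import Data.Fin using (Fin)
open import Data.List using () renaming (allFin to allFinL)
open import Data.Bool using (if_then_else_)
open import Relation.Nullary.Decidable using (⌊_⌋)
open import Relation.Binary.PropositionalEquality using (_≡_)
open import Data.Product using (∃)

-- Polynomials in ℤ[q], as (dense) coefficient lists, lowest degree first.
-- Trailing zeros are allowed; equality of polynomials is coefficientwise.

Poly : Set
Poly = List ℤ

coeff : Poly → ℕ → ℤ
coeff []      _       = + 0
coeff (a ∷ p) zero    = a
coeff (a ∷ p) (suc k) = coeff p k

_+ₚ_ : Poly → Poly → Poly
[]      +ₚ q       = q
(a ∷ p) +ₚ []      = a ∷ p
(a ∷ p) +ₚ (b ∷ q) = (a ℤ.+ b) ∷ (p +ₚ q)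

_*ₚ_ : Poly → Poly → Poly
[]      *ₚ q = []
(a ∷ p) *ₚ q = map (a ℤ.*_) q +ₚ (+ 0 ∷ (p *ₚ q))

oneₚ : Poly
oneₚ = + 1 ∷ []

qPow : ℕ → Poly
qPow k = replicate k (+ 0) ++ (+ 1 ∷ [])

_^ₚ_ : Poly → ℕ → Poly
p ^ₚ zero  = oneₚ
p ^ₚ suc r = p *ₚ (p ^ₚ r)

_∣ₚ_ : Poly → Poly → Set
d ∣ₚ f = ∃ λ (g : Poly) → ∀ k → coeff f k ≡ coeff (d *ₚ g) k

sumFin : ∀ {n} → (Fin n → ℕ) → ℕ
sumFin {n} f = foldr (λ x acc → f x ℕ.+ acc) 0 (allFinL n)

genPoly : ∀ {n} → (Fin n → ℕ) → Poly
genPoly {n} st = foldr (λ x acc → qPow (st x) +ₚ acc) [] (allFinL n)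

mod2m : (m : ℕ) → .{{NonZero m}} → ℕ → ℕ
mod2m m a = _%_ a (2 ℕ.* m) {{m*n≢0 2 m}}

classSum : ∀ {n} (m : ℕ) → .{{NonZero m}} → (Fin n → ℕ) → ℕ → ℕ → ℕ
classSum m st c j =
  sumFin (λ x → if ⌊ mod2m m (st x) ≟ c ⌋ then st x C j else 0)

-- Write each exponent as a = k·m + l with 0 ≤ l < m.  Modulo 1 + q^m one has q^(k·m + l) ≡ (-1)^k q^l,
-- and the quotient of q^(k·m + l) by 1 + q^m is an alternating sum of the monomials q^(i·m + l), i < k.
-- Hence if, for every residue l, the signed moments  Σ_{a ≡ l} (-1)^k C(k, j)  vanish for j < r, then
-- 1 + q^m divides the polynomial, and by Pascal's rule the quotient satisfies the same condition for
-- j < r - 1; induction on r gives divisibility by (1 + q^m)^r.  Splitting the class of l modulo m into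
-- the classes of l and l + m modulo 2m, the hypothesis says that the moments  Σ_{a ≡ l} (-1)^k C(a, j)
-- vanish for j < r.  On the class a ≡ l (mod m) the polynomial
-- m^i i! C(k, i) = ∏_{t<i} (a - l - t·m) of degree i in a is an integer combination of the C(a, j),
-- j ≤ i, so the two families of moments vanish together.

module Submission where

open import Defs
open import Data.Bool using (if_then_else_)
open import Data.Fin using (Fin)
open import Data.Integer using (ℤ; +_; _+_; _*_; _-_; -_)
import Data.Integer.Properties as ℤₚ
open import Data.Integer.Tactic.RingSolver using (solve-∀)
open import Data.List using (List; []; _∷_; _++_; map; foldr; replicate; concatMap)
open import Data.List using () renaming (allFin to allFinL)
open import Data.List.Properties using (foldr-map)
open import Data.Nat as ℕ
  using (ℕ; zero; suc; NonZero; _<_; _≤_; z≤n; s≤s; _%_; _/_; _^_; _!; _≡ᵇ_; _≟_; _<?_)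
import Data.Nat.Properties as ℕₚ
import Data.Nat.Tactic.RingSolver as ℕ-Solver
open import Data.Nat.DivMod
  using (m≡m%n+[m/n]*n; m%n<n; m<n⇒m%n≡m; m<n⇒m/n≡0; m≤n⇒[n∸m]%m≡n%m; m/n≡1+[m∸n]/n;
         [m+n]%n≡m%n; m∣n⇒o%n%m≡o%m; m%[n*o]/o≡m/o%n)
open import Data.Nat.Divisibility using (divides)
open import Data.Nat.Combinatorics using (_C_; nCk+nC[k+1]≡[n+1]C[k+1])
open import Data.Product using (_,_; proj₁; proj₂)
open import Level using (0ℓ)
open import Relation.Binary.Bundles using (Setoid)
import Relation.Binary.Reasoning.Setoid as SetoidReasoning
open import Relation.Binary.PropositionalEquality
  using (_≡_; _≢_; refl; sym; trans; cong; cong₂; subst; module ≡-Reasoning)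
open import Relation.Nullary using (yes; no; contradiction)
open import Relation.Nullary.Decidable using (⌊_⌋)

∑ : {A : Set} → List A → (A → ℤ) → ℤ
∑ xs f = foldr (λ x acc → f x + acc) (+ 0) xs

module _ {A : Set} where

  ∑-cong : ∀ (xs : List A) {f g : A → ℤ} → (∀ x → f x ≡ g x) → ∑ xs f ≡ ∑ xs g
  ∑-cong []       f≗g = refl
  ∑-cong (x ∷ xs) f≗g = cong₂ _+_ (f≗g x) (∑-cong xs f≗g)

  ∑-zero : ∀ (xs : List A) {f : A → ℤ} → (∀ x → f x ≡ + 0) → ∑ xs f ≡ + 0
  ∑-zero []       f≗0 = refl
  ∑-zero (x ∷ xs) f≗0 = cong₂ _+_ (f≗0 x) (∑-zero xs f≗0)

  ∑-+ : ∀ (xs : List A) (f g : A → ℤ) → ∑ xs (λ x → f x + g x) ≡ ∑ xs f + ∑ xs g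
  ∑-+ []       f g = refl
  ∑-+ (x ∷ xs) f g =
    trans (cong (_+_ (f x + g x)) (∑-+ xs f g)) (interchange (f x) (g x) (∑ xs f) (∑ xs g))
    where
    interchange : ∀ a b c d → (a + b) + (c + d) ≡ (a + c) + (b + d)
    interchange = solve-∀

  ∑-- : ∀ (xs : List A) (f g : A → ℤ) → ∑ xs (λ x → f x - g x) ≡ ∑ xs f - ∑ xs g
  ∑-- []       f g = refl
  ∑-- (x ∷ xs) f g =
    trans (cong (_+_ (f x - g x)) (∑-- xs f g)) (interchange (f x) (g x) (∑ xs f) (∑ xs g))
    where
    interchange : ∀ a b c d → (a - b) + (c - d) ≡ (a + c) - (b + d)
    interchange = solve-∀

  ∑-* : ∀ (xs : List A) c (f : A → ℤ) → ∑ xs (λ x → c * f x) ≡ c * ∑ xs f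
  ∑-* []       c f = sym (ℤₚ.*-zeroʳ c)
  ∑-* (x ∷ xs) c f =
    trans (cong (_+_ (c * f x)) (∑-* xs c f)) (sym (ℤₚ.*-distribˡ-+ c (f x) (∑ xs f)))

  ∑-++ : ∀ (xs ys : List A) (f : A → ℤ) → ∑ (xs ++ ys) f ≡ ∑ xs f + ∑ ys f
  ∑-++ []       ys f = sym (ℤₚ.+-identityˡ (∑ ys f))
  ∑-++ (x ∷ xs) ys f = trans (cong (_+_ (f x)) (∑-++ xs ys f)) (sym (ℤₚ.+-assoc (f x) _ _))

  ∑-pos : ∀ (xs : List A) (f : A → ℕ) →
          + foldr (λ x acc → f x ℕ.+ acc) 0 xs ≡ ∑ xs (λ x → + f x)
  ∑-pos []       f = refl
  ∑-pos (x ∷ xs) f = trans (ℤₚ.pos-+ (f x) _) (cong (_+_ (+ f x)) (∑-pos xs f))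

δ : ℕ → ℕ → ℤ
δ a b = if a ≡ᵇ b then + 1 else + 0

δ-refl : ∀ a → δ a a ≡ + 1
δ-refl zero    = refl
δ-refl (suc a) = δ-refl a

δ-≢ : ∀ {a b} → a ≢ b → δ a b ≡ + 0
δ-≢ {zero}  {zero}  a≢b = contradiction refl a≢b
δ-≢ {zero}  {suc b} a≢b = refl
δ-≢ {suc a} {zero}  a≢b = refl
δ-≢ {suc a} {suc b} a≢b = δ-≢ (λ a≡b → a≢b (cong suc a≡b))

δ-+ : ∀ c a b → δ (c ℕ.+ a) (c ℕ.+ b) ≡ δ a b
δ-+ zero    a b = refl
δ-+ (suc c) a b = δ-+ c a b

pos-if-≟ : ∀ a b n → + (if ⌊ a ≟ b ⌋ then n else 0) ≡ + n * δ a b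
pos-if-≟ a b n with a ≟ b
... | yes refl = sym (trans (cong (+ n *_) (δ-refl a)) (ℤₚ.*-identityʳ (+ n)))
... | no  a≢b  = sym (trans (cong (+ n *_) (δ-≢ a≢b)) (ℤₚ.*-zeroʳ (+ n)))

-- Arithmetic of coefficient lists

infix 4 _≈_
record _≈_ (p q : Poly) : Set where
  constructor coeffwise
  field coeff-≡ : ∀ k → coeff p k ≡ coeff q k
open _≈_

≈-setoid : Setoid 0ℓ 0ℓ
≈-setoid = record
  { Carrier       = Poly
  ; _≈_           = _≈_
  ; isEquivalence = record
    { refl  = coeffwise λ k → refl
    ; sym   = λ p≈q → coeffwise λ k → sym (coeff-≡ p≈q k)
    ; trans = λ p≈q q≈r → coeffwise λ k → trans (coeff-≡ p≈q k) (coeff-≡ q≈r k)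
    }
  }

open Setoid ≈-setoid using ()
  renaming (refl to ≈-refl; reflexive to ≈-reflexive; sym to ≈-sym; trans to ≈-trans)
module ≈-Reasoning = SetoidReasoning ≈-setoid

infixr 25 _·ₚ_
_·ₚ_ : ℤ → Poly → Poly
c ·ₚ p = map (c *_) p

shift : ℕ → Poly → Poly
shift e p = replicate e (+ 0) ++ p

∑ₚ : {A : Set} → List A → (A → Poly) → Poly
∑ₚ xs f = foldr (λ x acc → f x +ₚ acc) [] xs

coeff-+ : ∀ p q k → coeff (p +ₚ q) k ≡ coeff p k + coeff q k
coeff-+ []      q       k       = sym (ℤₚ.+-identityˡ (coeff q k))
coeff-+ (a ∷ p) []      k       = sym (ℤₚ.+-identityʳ (coeff (a ∷ p) k))
coeff-+ (a ∷ p) (b ∷ q) zero    = refl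
coeff-+ (a ∷ p) (b ∷ q) (suc k) = coeff-+ p q k

coeff-· : ∀ c p k → coeff (c ·ₚ p) k ≡ c * coeff p k
coeff-· c []      k       = sym (ℤₚ.*-zeroʳ c)
coeff-· c (a ∷ p) zero    = refl
coeff-· c (a ∷ p) (suc k) = coeff-· c p k

coeff-qPow : ∀ e k → coeff (qPow e) k ≡ δ e k
coeff-qPow zero    zero    = refl
coeff-qPow zero    (suc k) = refl
coeff-qPow (suc e) zero    = refl
coeff-qPow (suc e) (suc k) = coeff-qPow e k

coeff-∑ₚ : ∀ {A : Set} (xs : List A) (f : A → Poly) k → coeff (∑ₚ xs f) k ≡ ∑ xs (λ x → coeff (f x) k)
coeff-∑ₚ []       f k = refl
coeff-∑ₚ (x ∷ xs) f k = trans (coeff-+ (f x) (∑ₚ xs f) k) (cong (_+_ (coeff (f x) k)) (coeff-∑ₚ xs f k))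

∷-cong : ∀ {a b p q} → a ≡ b → p ≈ q → a ∷ p ≈ b ∷ q
∷-cong a≡b p≈q = coeffwise λ { zero → a≡b ; (suc k) → coeff-≡ p≈q k }

0∷-≈[] : ∀ {p} → p ≈ [] → + 0 ∷ p ≈ []
0∷-≈[] p≈[] = coeffwise λ { zero → refl ; (suc k) → coeff-≡ p≈[] k }

+-cong : ∀ {p p′ q q′} → p ≈ p′ → q ≈ q′ → p +ₚ q ≈ p′ +ₚ q′
+-cong {p} {p′} {q} {q′} p≈p′ q≈q′ = coeffwise λ k → begin
  coeff (p +ₚ q) k         ≡⟨ coeff-+ p q k ⟩
  coeff p k + coeff q k    ≡⟨ cong₂ _+_ (coeff-≡ p≈p′ k) (coeff-≡ q≈q′ k) ⟩
  coeff p′ k + coeff q′ k  ≡⟨ coeff-+ p′ q′ k ⟨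
  coeff (p′ +ₚ q′) k       ∎
  where open ≡-Reasoning

+-congˡ : ∀ p {q q′} → q ≈ q′ → p +ₚ q ≈ p +ₚ q′
+-congˡ p = +-cong ≈-refl

+-congʳ : ∀ r {p p′} → p ≈ p′ → p +ₚ r ≈ p′ +ₚ r
+-congʳ r p≈p′ = +-cong p≈p′ ≈-refl

+-identityʳ : ∀ p → p +ₚ [] ≈ p
+-identityʳ []      = ≈-refl
+-identityʳ (a ∷ p) = ≈-refl

+-assoc : ∀ p q r → (p +ₚ q) +ₚ r ≈ p +ₚ (q +ₚ r)
+-assoc []      q       r       = ≈-refl
+-assoc (a ∷ p) []      r       = ≈-refl
+-assoc (a ∷ p) (b ∷ q) []      = ≈-refl
+-assoc (a ∷ p) (b ∷ q) (c ∷ r) = ∷-cong (ℤₚ.+-assoc a b c) (+-assoc p q r)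

+-interchange : ∀ p q r s → (p +ₚ q) +ₚ (r +ₚ s) ≈ (p +ₚ r) +ₚ (q +ₚ s)
+-interchange p q r s = coeffwise λ k → begin
  coeff ((p +ₚ q) +ₚ (r +ₚ s)) k
    ≡⟨ trans (coeff-+ (p +ₚ q) (r +ₚ s) k) (cong₂ _+_ (coeff-+ p q k) (coeff-+ r s k)) ⟩
  (coeff p k + coeff q k) + (coeff r k + coeff s k)
    ≡⟨ interchange (coeff p k) (coeff q k) (coeff r k) (coeff s k) ⟩
  (coeff p k + coeff r k) + (coeff q k + coeff s k)
    ≡⟨ trans (coeff-+ (p +ₚ r) (q +ₚ s) k) (cong₂ _+_ (coeff-+ p r k) (coeff-+ q s k)) ⟨
  coeff ((p +ₚ r) +ₚ (q +ₚ s)) k ∎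
  where
  open ≡-Reasoning
  interchange : ∀ a b c d → (a + b) + (c + d) ≡ (a + c) + (b + d)
  interchange = solve-∀

·-cong : ∀ c {p q} → p ≈ q → c ·ₚ p ≈ c ·ₚ q
·-cong c {p} {q} p≈q = coeffwise λ k →
  trans (coeff-· c p k) (trans (cong (c *_) (coeff-≡ p≈q k)) (sym (coeff-· c q k)))

·-zeroˡ : ∀ p → (+ 0) ·ₚ p ≈ []
·-zeroˡ p = coeffwise (coeff-· (+ 0) p)

·-identityˡ : ∀ p → (+ 1) ·ₚ p ≈ p
·-identityˡ []      = ≈-refl
·-identityˡ (a ∷ p) = ∷-cong (ℤₚ.*-identityˡ a) (·-identityˡ p)

·-assoc : ∀ a b p → (a * b) ·ₚ p ≈ a ·ₚ (b ·ₚ p)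
·-assoc a b []      = ≈-refl
·-assoc a b (c ∷ p) = ∷-cong (ℤₚ.*-assoc a b c) (·-assoc a b p)

·-distribʳ : ∀ a b p → (a + b) ·ₚ p ≈ a ·ₚ p +ₚ b ·ₚ p
·-distribʳ a b []      = ≈-refl
·-distribʳ a b (c ∷ p) = ∷-cong (ℤₚ.*-distribʳ-+ c a b) (·-distribʳ a b p)

·-distribˡ : ∀ a p q → a ·ₚ (p +ₚ q) ≈ a ·ₚ p +ₚ a ·ₚ q
·-distribˡ a []      q       = ≈-refl
·-distribˡ a (b ∷ p) []      = ≈-refl
·-distribˡ a (b ∷ p) (c ∷ q) = ∷-cong (ℤₚ.*-distribˡ-+ a b c) (·-distribˡ a p q)

·-shift : ∀ c e p → shift e (c ·ₚ p) ≈ c ·ₚ shift e p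
·-shift c zero    p = ≈-refl
·-shift c (suc e) p = ∷-cong (sym (ℤₚ.*-zeroʳ c)) (·-shift c e p)

·-+-cancel : ∀ w p q → (w ·ₚ p +ₚ w ·ₚ q) +ₚ (- w) ·ₚ p ≈ w ·ₚ q
·-+-cancel w p q = coeffwise λ k → begin
  coeff ((w ·ₚ p +ₚ w ·ₚ q) +ₚ (- w) ·ₚ p) k
    ≡⟨ trans (coeff-+ (w ·ₚ p +ₚ w ·ₚ q) ((- w) ·ₚ p) k)
             (cong₂ _+_ (trans (coeff-+ (w ·ₚ p) (w ·ₚ q) k) (cong₂ _+_ (coeff-· w p k) (coeff-· w q k)))
                        (coeff-· (- w) p k)) ⟩
  (w * coeff p k + w * coeff q k) + (- w) * coeff p k  ≡⟨ cancel w (coeff p k) (coeff q k) ⟩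
  w * coeff q k                                         ≡⟨ coeff-· w q k ⟨
  coeff (w ·ₚ q) k                                      ∎
  where
  open ≡-Reasoning
  cancel : ∀ w a b → (w * a + w * b) + (- w) * a ≡ w * b
  cancel = solve-∀

shift-qPow : ∀ e f → shift e (qPow f) ≡ qPow (e ℕ.+ f)
shift-qPow zero    f = refl
shift-qPow (suc e) f = cong (+ 0 ∷_) (shift-qPow e f)

*-zeroʳ : ∀ p → p *ₚ [] ≈ []
*-zeroʳ []      = ≈-refl
*-zeroʳ (a ∷ p) = 0∷-≈[] (*-zeroʳ p)

*-identityˡ : ∀ p → oneₚ *ₚ p ≈ p
*-identityˡ []      = 0∷-≈[] ≈-refl
*-identityˡ (a ∷ p) = ∷-cong (trans (ℤₚ.+-identityʳ _) (ℤₚ.*-identityˡ a))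
                             (≈-trans (+-identityʳ ((+ 1) ·ₚ p)) (·-identityˡ p))

0∷-* : ∀ p q → (+ 0 ∷ p) *ₚ q ≈ + 0 ∷ p *ₚ q
0∷-* p q = +-congʳ (+ 0 ∷ p *ₚ q) (·-zeroˡ q)

*-congˡ : ∀ p {q q′} → q ≈ q′ → p *ₚ q ≈ p *ₚ q′
*-congˡ []      q≈q′ = ≈-refl
*-congˡ (a ∷ p) q≈q′ = +-cong (·-cong a q≈q′) (∷-cong refl (*-congˡ p q≈q′))

*-distribʳ : ∀ p q r → (p +ₚ q) *ₚ r ≈ (p *ₚ r) +ₚ (q *ₚ r)
*-distribʳ []      q       r = ≈-refl
*-distribʳ (a ∷ p) []      r = ≈-sym (+-identityʳ ((a ∷ p) *ₚ r))
*-distribʳ (a ∷ p) (b ∷ q) r =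
  ≈-trans (+-cong (·-distribʳ a b r) (∷-cong refl (*-distribʳ p q r)))
          (+-interchange (a ·ₚ r) (b ·ₚ r) (+ 0 ∷ p *ₚ r) (+ 0 ∷ q *ₚ r))

*-distribˡ : ∀ p q r → p *ₚ (q +ₚ r) ≈ (p *ₚ q) +ₚ (p *ₚ r)
*-distribˡ []      q r = ≈-refl
*-distribˡ (a ∷ p) q r =
  ≈-trans (+-cong (·-distribˡ a q r) (∷-cong refl (*-distribˡ p q r)))
          (+-interchange (a ·ₚ q) (a ·ₚ r) (+ 0 ∷ p *ₚ q) (+ 0 ∷ p *ₚ r))

·-* : ∀ a p q → (a ·ₚ p) *ₚ q ≈ a ·ₚ (p *ₚ q)
·-* a []      q = ≈-refl
·-* a (b ∷ p) q = begin
  (a * b) ·ₚ q +ₚ (+ 0 ∷ ((a ·ₚ p) *ₚ q))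
    ≈⟨ +-cong (·-assoc a b q) (∷-cong (sym (ℤₚ.*-zeroʳ a)) (·-* a p q)) ⟩
  a ·ₚ (b ·ₚ q) +ₚ a ·ₚ (+ 0 ∷ p *ₚ q)
    ≈⟨ ·-distribˡ a (b ·ₚ q) (+ 0 ∷ p *ₚ q) ⟨
  a ·ₚ ((b ∷ p) *ₚ q) ∎
  where open ≈-Reasoning

*-assoc : ∀ p q r → (p *ₚ q) *ₚ r ≈ p *ₚ (q *ₚ r)
*-assoc []      q r = ≈-refl
*-assoc (a ∷ p) q r = begin
  (a ·ₚ q +ₚ (+ 0 ∷ p *ₚ q)) *ₚ r           ≈⟨ *-distribʳ (a ·ₚ q) (+ 0 ∷ p *ₚ q) r ⟩
  ((a ·ₚ q) *ₚ r) +ₚ ((+ 0 ∷ p *ₚ q) *ₚ r)      ≈⟨ +-cong (·-* a q r) (0∷-* (p *ₚ q) r) ⟩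
  a ·ₚ (q *ₚ r) +ₚ (+ 0 ∷ ((p *ₚ q) *ₚ r))    ≈⟨ +-congˡ (a ·ₚ (q *ₚ r)) (∷-cong refl (*-assoc p q r)) ⟩
  (a ∷ p) *ₚ (q *ₚ r)                        ∎
  where open ≈-Reasoning

qPow-* : ∀ e p → qPow e *ₚ p ≈ shift e p
qPow-* zero    p = *-identityˡ p
qPow-* (suc e) p = ≈-trans (0∷-* (qPow e) p) (∷-cong refl (qPow-* e p))

∣ₚ-resp-≈ : ∀ d {f f′} → f ≈ f′ → d ∣ₚ f′ → d ∣ₚ f
∣ₚ-resp-≈ d f≈f′ (g , f′≈dg) = g , λ k → trans (coeff-≡ f≈f′ k) (f′≈dg k)

∑ₚ-cong : ∀ {A : Set} (xs : List A) {f g : A → Poly} → (∀ x → f x ≈ g x) → ∑ₚ xs f ≈ ∑ₚ xs g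
∑ₚ-cong []       f≈g = ≈-refl
∑ₚ-cong (x ∷ xs) f≈g = +-cong (f≈g x) (∑ₚ-cong xs f≈g)

∑ₚ-++ : ∀ {A : Set} (xs ys : List A) (f : A → Poly) → ∑ₚ (xs ++ ys) f ≈ ∑ₚ xs f +ₚ ∑ₚ ys f
∑ₚ-++ xs ys f = coeffwise λ k → begin
  coeff (∑ₚ (xs ++ ys) f) k                         ≡⟨ coeff-∑ₚ (xs ++ ys) f k ⟩
  ∑ (xs ++ ys) (λ x → coeff (f x) k)                ≡⟨ ∑-++ xs ys (λ x → coeff (f x) k) ⟩
  ∑ xs (λ x → coeff (f x) k) + ∑ ys (λ x → coeff (f x) k)
    ≡⟨ cong₂ _+_ (coeff-∑ₚ xs f k) (coeff-∑ₚ ys f k) ⟨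
  coeff (∑ₚ xs f) k + coeff (∑ₚ ys f) k             ≡⟨ coeff-+ (∑ₚ xs f) (∑ₚ ys f) k ⟨
  coeff (∑ₚ xs f +ₚ ∑ₚ ys f) k                      ∎
  where open ≡-Reasoning

-- Division by 1 + q^m

-1^_ : ℕ → ℤ
-1^ zero  = + 1
-1^ suc k = - (-1^ k)

-- The library's _C_ is defined by division and does not unfold along Pascal's rule on open terms.
binom : ℕ → ℕ → ℕ
binom n       zero    = 1
binom zero    (suc k) = 0
binom (suc n) (suc k) = binom n k ℕ.+ binom n (suc k)

module Division (m : ℕ) where

  A : Poly
  A = oneₚ +ₚ qPow m

  A-* : ∀ p → A *ₚ p ≈ p +ₚ shift m p
  A-* p = ≈-trans (*-distribʳ oneₚ (qPow m) p) (+-cong (*-identityˡ p) (qPow-* m p))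

  ·qPow-m+ : ∀ w e → w ·ₚ qPow (m ℕ.+ e) ≈ (A *ₚ (w ·ₚ qPow e)) +ₚ (- w) ·ₚ qPow e
  ·qPow-m+ w e = ≈-sym (begin
    (A *ₚ (w ·ₚ qPow e)) +ₚ (- w) ·ₚ qPow e
      ≈⟨ +-congʳ ((- w) ·ₚ qPow e) (A-* (w ·ₚ qPow e)) ⟩
    (w ·ₚ qPow e +ₚ shift m (w ·ₚ qPow e)) +ₚ (- w) ·ₚ qPow e
      ≈⟨ +-congʳ ((- w) ·ₚ qPow e) (+-congˡ (w ·ₚ qPow e) (·-shift w m (qPow e))) ⟩
    (w ·ₚ qPow e +ₚ w ·ₚ shift m (qPow e)) +ₚ (- w) ·ₚ qPow e
      ≡⟨ cong (λ p → (w ·ₚ qPow e +ₚ w ·ₚ p) +ₚ (- w) ·ₚ qPow e) (shift-qPow m e) ⟩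
    (w ·ₚ qPow e +ₚ w ·ₚ qPow (m ℕ.+ e)) +ₚ (- w) ·ₚ qPow e
      ≈⟨ ·-+-cancel w (qPow e) (qPow (m ℕ.+ e)) ⟩
    w ·ₚ qPow (m ℕ.+ e) ∎)
    where open ≈-Reasoning

  data Term : Set where
    term : (weight : ℤ) (block residue : ℕ) → Term

  ⟦_⟧ₜ : Term → Poly
  ⟦ term w k l ⟧ₜ = w ·ₚ qPow (k ℕ.* m ℕ.+ l)

  ⟦_⟧ : List Term → Poly
  ⟦ ts ⟧ = ∑ₚ ts ⟦_⟧ₜ

  alternatingTerms : ℤ → ℕ → ℕ → List Term
  alternatingTerms w zero    l = []
  alternatingTerms w (suc k) l = term w k l ∷ alternatingTerms (- w) k l

  quotient : Term → List Term
  quotient (term w k l) = alternatingTerms w k l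

  remainder : Term → Poly
  remainder (term w k l) = (w * -1^ k) ·ₚ qPow l

  term-division : ∀ w k l → let t = term w k l in ⟦ t ⟧ₜ ≈ (A *ₚ ⟦ quotient t ⟧) +ₚ remainder t
  term-division w zero l =
    ≈-sym (+-cong (*-zeroʳ A) (≈-reflexive (cong (_·ₚ qPow l) (ℤₚ.*-identityʳ w))))
  term-division w (suc k) l = begin
    w ·ₚ qPow (suc k ℕ.* m ℕ.+ l)
      ≡⟨ cong (λ e → w ·ₚ qPow e) (ℕₚ.+-assoc m (k ℕ.* m) l) ⟩
    w ·ₚ qPow (m ℕ.+ (k ℕ.* m ℕ.+ l))
      ≈⟨ ·qPow-m+ w (k ℕ.* m ℕ.+ l) ⟩
    (A *ₚ T) +ₚ ⟦ term (- w) k l ⟧ₜ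
      ≈⟨ +-congˡ (A *ₚ T) (term-division (- w) k l) ⟩
    (A *ₚ T) +ₚ ((A *ₚ Q) +ₚ remainder (term (- w) k l))
      ≈⟨ +-assoc (A *ₚ T) (A *ₚ Q) _ ⟨
    ((A *ₚ T) +ₚ (A *ₚ Q)) +ₚ remainder (term (- w) k l)
      ≈⟨ +-cong (*-distribˡ A T Q) (≈-reflexive sign-flip) ⟨
    (A *ₚ (T +ₚ Q)) +ₚ remainder (term w (suc k) l) ∎
    where
    open ≈-Reasoning
    T Q : Poly
    T = ⟦ term w k l ⟧ₜ
    Q = ⟦ alternatingTerms (- w) k l ⟧
    sign-flip : remainder (term w (suc k) l) ≡ remainder (term (- w) k l)
    sign-flip = cong (_·ₚ qPow l) (ring w (-1^ k))
      where
      ring : ∀ w s → w * - s ≡ - w * s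
      ring = solve-∀

  division : ∀ ts → ⟦ ts ⟧ ≈ (A *ₚ ⟦ concatMap quotient ts ⟧) +ₚ ∑ₚ ts remainder
  division []       = ≈-sym (≈-trans (+-identityʳ (A *ₚ [])) (*-zeroʳ A))
  division (t@(term w k l) ∷ ts) = begin
    ⟦ t ⟧ₜ +ₚ ⟦ ts ⟧
      ≈⟨ +-cong (term-division w k l) (division ts) ⟩
    ((A *ₚ ⟦ quotient t ⟧) +ₚ remainder t) +ₚ ((A *ₚ ⟦ Qs ⟧) +ₚ ∑ₚ ts remainder)
      ≈⟨ +-interchange (A *ₚ ⟦ quotient t ⟧) (remainder t) (A *ₚ ⟦ Qs ⟧) (∑ₚ ts remainder) ⟩
    ((A *ₚ ⟦ quotient t ⟧) +ₚ (A *ₚ ⟦ Qs ⟧)) +ₚ (remainder t +ₚ ∑ₚ ts remainder)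
      ≈⟨ +-congʳ (∑ₚ (t ∷ ts) remainder) (*-distribˡ A ⟦ quotient t ⟧ ⟦ Qs ⟧) ⟨
    (A *ₚ (⟦ quotient t ⟧ +ₚ ⟦ Qs ⟧)) +ₚ ∑ₚ (t ∷ ts) remainder
      ≈⟨ +-congʳ (∑ₚ (t ∷ ts) remainder) (*-congˡ A (∑ₚ-++ (quotient t) Qs ⟦_⟧ₜ)) ⟨
    (A *ₚ ⟦ quotient t ++ Qs ⟧) +ₚ ∑ₚ (t ∷ ts) remainder ∎
    where
    open ≈-Reasoning
    Qs : List Term
    Qs = concatMap quotient ts

  termMoment : Term → ℕ → ℕ → ℤ
  termMoment (term w k l′) l j = δ l′ l * (w * -1^ k) * + binom k j

  moment : List Term → ℕ → ℕ → ℤ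
  moment ts l j = ∑ ts (λ t → termMoment t l j)

  -- Pascal's rule turns the alternating sum over the quotient into a single binomial coefficient.
  alternatingTerms-moment : ∀ w k l′ l j →
    moment (alternatingTerms w k l′) l j ≡ - termMoment (term w k l′) l (suc j)
  alternatingTerms-moment w zero l′ l j = vanish (δ l′ l) w
    where
    vanish : ∀ d w → + 0 ≡ - (d * (w * + 1) * + 0)
    vanish = solve-∀
  alternatingTerms-moment w (suc k) l′ l j = begin
    termMoment (term w k l′) l j + moment (alternatingTerms (- w) k l′) l j
      ≡⟨ cong (_+_ (termMoment (term w k l′) l j)) (alternatingTerms-moment (- w) k l′ l j) ⟩
    d * (w * s) * + binom k j + - (d * (- w * s) * + binom k (suc j))
      ≡⟨ pascal d w s (+ binom k j) (+ binom k (suc j)) ⟩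
    - (d * (w * - s) * (+ binom k j + + binom k (suc j)))
      ≡⟨ cong (λ b → - (d * (w * - s) * b)) (ℤₚ.pos-+ (binom k j) (binom k (suc j))) ⟨
    - termMoment (term w (suc k) l′) l (suc j) ∎
    where
    open ≡-Reasoning
    d s : ℤ
    d = δ l′ l
    s = -1^ k
    pascal : ∀ d w s b₀ b₁ → d * (w * s) * b₀ + - (d * (- w * s) * b₁) ≡ - (d * (w * - s) * (b₀ + b₁))
    pascal = solve-∀

  quotient-moment : ∀ ts l j → moment (concatMap quotient ts) l j ≡ - moment ts l (suc j)
  quotient-moment []                 l j = refl
  quotient-moment (term w k l′ ∷ ts) l j = begin
    moment (alternatingTerms w k l′ ++ concatMap quotient ts) l j
      ≡⟨ ∑-++ (alternatingTerms w k l′) (concatMap quotient ts) (λ t → termMoment t l j) ⟩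
    moment (alternatingTerms w k l′) l j + moment (concatMap quotient ts) l j
      ≡⟨ cong₂ _+_ (alternatingTerms-moment w k l′ l j) (quotient-moment ts l j) ⟩
    - termMoment (term w k l′) l (suc j) + - moment ts l (suc j)
      ≡⟨ ℤₚ.neg-distrib-+ (termMoment (term w k l′) l (suc j)) (moment ts l (suc j)) ⟨
    - moment (term w k l′ ∷ ts) l (suc j) ∎
    where open ≡-Reasoning

  coeff-remainders : ∀ ts i → coeff (∑ₚ ts remainder) i ≡ moment ts i 0
  coeff-remainders ts i = trans (coeff-∑ₚ ts remainder i) (∑-cong ts coeff-remainder)
    where
    coeff-remainder : ∀ t → coeff (remainder t) i ≡ termMoment t i 0
    coeff-remainder (term w k l) =
      trans (coeff-· (w * -1^ k) (qPow l) i)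
            (trans (cong (_*_ (w * -1^ k)) (coeff-qPow l i)) (reorder (w * -1^ k) (δ l i)))
      where
      reorder : ∀ c d → c * d ≡ d * c * + 1
      reorder = solve-∀

  divisible-if-moments-vanish : ∀ r ts → (∀ l j → j < r → moment ts l j ≡ + 0) → (A ^ₚ r) ∣ₚ ⟦ ts ⟧
  divisible-if-moments-vanish zero    ts _      = ⟦ ts ⟧ , coeff-≡ (≈-sym (*-identityˡ ⟦ ts ⟧))
  divisible-if-moments-vanish (suc r) ts vanish = g , coeff-≡ (begin
    ⟦ ts ⟧                                          ≈⟨ division ts ⟩
    (A *ₚ ⟦ concatMap quotient ts ⟧) +ₚ ∑ₚ ts remainder ≈⟨ +-cong (*-congˡ A ⟦Q⟧≈) remainders≈[] ⟩
    (A *ₚ ((A ^ₚ r) *ₚ g)) +ₚ []                    ≈⟨ +-identityʳ (A *ₚ ((A ^ₚ r) *ₚ g)) ⟩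
    A *ₚ ((A ^ₚ r) *ₚ g)                            ≈⟨ *-assoc A (A ^ₚ r) g ⟨
    (A ^ₚ suc r) *ₚ g                               ∎)
    where
    open ≈-Reasoning
    quotient-divisible : (A ^ₚ r) ∣ₚ ⟦ concatMap quotient ts ⟧
    quotient-divisible = divisible-if-moments-vanish r (concatMap quotient ts) λ l j j<r →
      trans (quotient-moment ts l j) (cong -_ (vanish l (suc j) (s≤s j<r)))
    g : Poly
    g = proj₁ quotient-divisible
    ⟦Q⟧≈ : ⟦ concatMap quotient ts ⟧ ≈ (A ^ₚ r) *ₚ g
    ⟦Q⟧≈ = coeffwise (proj₂ quotient-divisible)
    remainders≈[] : ∑ₚ ts remainder ≈ []
    remainders≈[] = coeffwise λ i → trans (coeff-remainders ts i) (vanish i 0 (s≤s z≤n))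

-- Binomial moments on a residue class

binom≡C : ∀ n k → binom n k ≡ n C k
binom≡C n       zero    = refl
binom≡C zero    (suc k) = refl
binom≡C (suc n) (suc k) =
  trans (cong₂ ℕ._+_ (binom≡C n k) (binom≡C n (suc k))) (nCk+nC[k+1]≡[n+1]C[k+1] n k)

binom-1 : ∀ n → binom n 1 ≡ n
binom-1 zero    = refl
binom-1 (suc n) = cong suc (binom-1 n)

binom-absorptionℕ : ∀ n j → n ℕ.* binom n j ≡ suc j ℕ.* binom n (suc j) ℕ.+ j ℕ.* binom n j
binom-absorptionℕ zero    zero    = refl
binom-absorptionℕ zero    (suc j) = sym (cong₂ ℕ._+_ (ℕₚ.*-zeroʳ (suc (suc j))) (ℕₚ.*-zeroʳ (suc j)))
binom-absorptionℕ (suc n) zero    = begin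
  suc n ℕ.* 1                       ≡⟨ ℕₚ.*-identityʳ (suc n) ⟩
  suc n                             ≡⟨ cong suc (binom-1 n) ⟨
  binom (suc n) 1                   ≡⟨ ℕₚ.*-identityˡ (binom (suc n) 1) ⟨
  1 ℕ.* binom (suc n) 1             ≡⟨ ℕₚ.+-identityʳ (1 ℕ.* binom (suc n) 1) ⟨
  1 ℕ.* binom (suc n) 1 ℕ.+ 0       ∎
  where open ≡-Reasoning
binom-absorptionℕ (suc n) (suc j) = begin
  suc n ℕ.* (b₀ ℕ.+ b₁)
    ≡⟨ expand n b₀ b₁ ⟩
  (b₀ ℕ.+ b₁) ℕ.+ (n ℕ.* b₀ ℕ.+ n ℕ.* b₁)
    ≡⟨ cong₂ (λ x y → (b₀ ℕ.+ b₁) ℕ.+ (x ℕ.+ y)) (binom-absorptionℕ n j) (binom-absorptionℕ n (suc j)) ⟩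
  (b₀ ℕ.+ b₁) ℕ.+ ((suc j ℕ.* b₁ ℕ.+ j ℕ.* b₀) ℕ.+ (suc (suc j) ℕ.* b₂ ℕ.+ suc j ℕ.* b₁))
    ≡⟨ collect j b₀ b₁ b₂ ⟩
  suc (suc j) ℕ.* (b₁ ℕ.+ b₂) ℕ.+ suc j ℕ.* (b₀ ℕ.+ b₁) ∎
  where
  open ≡-Reasoning
  b₀ b₁ b₂ : ℕ
  b₀ = binom n j
  b₁ = binom n (suc j)
  b₂ = binom n (suc (suc j))
  expand : ∀ n b₀ b₁ → suc n ℕ.* (b₀ ℕ.+ b₁) ≡ (b₀ ℕ.+ b₁) ℕ.+ (n ℕ.* b₀ ℕ.+ n ℕ.* b₁)
  expand = ℕ-Solver.solve-∀
  collect : ∀ j b₀ b₁ b₂ →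
    (b₀ ℕ.+ b₁) ℕ.+ ((suc j ℕ.* b₁ ℕ.+ j ℕ.* b₀) ℕ.+ (suc (suc j) ℕ.* b₂ ℕ.+ suc j ℕ.* b₁))
    ≡ suc (suc j) ℕ.* (b₁ ℕ.+ b₂) ℕ.+ suc j ℕ.* (b₀ ℕ.+ b₁)
  collect = ℕ-Solver.solve-∀

binom-absorption : ∀ n j → (+ n - + j) * + binom n j ≡ + suc j * + binom n (suc j)
binom-absorption n j = begin
  (+ n - + j) * + binom n j                            ≡⟨ ℤₚ.*-distribʳ-+ (+ binom n j) (+ n) (- + j) ⟩
  + n * + binom n j + - + j * + binom n j              ≡⟨ cong (λ x → x + - + j * + binom n j) n*binom ⟩
  (+ suc j * + binom n (suc j) + + j * + binom n j) + - + j * + binom n j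
    ≡⟨ cancel (+ suc j * + binom n (suc j)) (+ j) (+ binom n j) ⟩
  + suc j * + binom n (suc j) ∎
  where
  open ≡-Reasoning
  n*binom : + n * + binom n j ≡ + suc j * + binom n (suc j) + + j * + binom n j
  n*binom = begin
    + n * + binom n j                                   ≡⟨ ℤₚ.pos-* n (binom n j) ⟨
    + (n ℕ.* binom n j)                                 ≡⟨ cong +_ (binom-absorptionℕ n j) ⟩
    + (suc j ℕ.* binom n (suc j) ℕ.+ j ℕ.* binom n j)   ≡⟨ ℤₚ.pos-+ (suc j ℕ.* binom n (suc j)) _ ⟩
    + (suc j ℕ.* binom n (suc j)) + + (j ℕ.* binom n j) ≡⟨ cong₂ _+_ (ℤₚ.pos-* (suc j) _) (ℤₚ.pos-* j _) ⟩
    + suc j * + binom n (suc j) + + j * + binom n j     ∎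
  cancel : ∀ x j b → (x + j * b) + - j * b ≡ x
  cancel = solve-∀

data BinomialSpan (r : ℕ) : (ℕ → ℤ) → Set where
  binomial  : ∀ {j} → j < r → BinomialSpan r (λ a → + binom a j)
  _⊕_       : ∀ {φ ψ} → BinomialSpan r φ → BinomialSpan r ψ → BinomialSpan r (λ a → φ a + ψ a)
  scale     : ∀ {φ} c → BinomialSpan r φ → BinomialSpan r (λ a → c * φ a)
  pointwise : ∀ {φ ψ} → (∀ a → φ a ≡ ψ a) → BinomialSpan r φ → BinomialSpan r ψ

span-*-linear : ∀ {r φ} c → BinomialSpan r φ → BinomialSpan (suc r) (λ a → (+ a - c) * φ a)
span-*-linear c (binomial {j} j<r) =
  pointwise step (scale (+ suc j) (binomial (s≤s j<r)) ⊕ scale (+ j - c) (binomial (ℕₚ.m<n⇒m<1+n j<r)))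
  where
  step : ∀ a → + suc j * + binom a (suc j) + (+ j - c) * + binom a j ≡ (+ a - c) * + binom a j
  step a = trans (cong (λ x → x + (+ j - c) * + binom a j) (sym (binom-absorption a j)))
                 (regroup (+ a) (+ j) c (+ binom a j))
    where
    regroup : ∀ a j c b → (a - j) * b + (j - c) * b ≡ (a - c) * b
    regroup = solve-∀
span-*-linear c (φ ⊕ ψ) =
  pointwise (λ a → sym (ℤₚ.*-distribˡ-+ (+ a - c) _ _)) (span-*-linear c φ ⊕ span-*-linear c ψ)
span-*-linear c (scale d φ) =
  pointwise (λ a → swap d (+ a - c) _) (scale d (span-*-linear c φ))
  where
  swap : ∀ d x y → d * (x * y) ≡ x * (d * y)
  swap = solve-∀
span-*-linear c (pointwise φ≗ψ φ) = pointwise (λ a → cong (_*_ (+ a - c)) (φ≗ψ a)) (span-*-linear c φ)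

pos-+* : ∀ x y z → + (x ℕ.+ y ℕ.* z) ≡ + x + + y * + z
pos-+* x y z = trans (ℤₚ.pos-+ x (y ℕ.* z)) (cong (_+_ (+ x)) (ℤₚ.pos-* y z))

module ResidueClass (m : ℕ) .{{_ : NonZero m}} where

  falling : ℕ → ℕ → ℕ → ℤ
  falling l zero    a = + 1
  falling l (suc i) a = (+ a - + (l ℕ.+ i ℕ.* m)) * falling l i a

  falling-span : ∀ l i → BinomialSpan (suc i) (falling l i)
  falling-span l zero    = binomial (s≤s z≤n)
  falling-span l (suc i) = span-*-linear (+ (l ℕ.+ i ℕ.* m)) (falling-span l i)

  falling-on-class : ∀ {l a} → a % m ≡ l → ∀ i → falling l i a ≡ + (m ^ i ℕ.* i !) * + binom (a / m) i
  falling-on-class a%m≡l zero = refl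
  falling-on-class {l} {a} a%m≡l (suc i) = begin
    (+ a - + (l ℕ.+ i ℕ.* m)) * falling l i a     ≡⟨ cong₂ _*_ a-step (falling-on-class a%m≡l i) ⟩
    ((+ k - + i) * + m) * (+ D * + binom k i)      ≡⟨ regroup (+ k - + i) (+ m) (+ D) (+ binom k i) ⟩
    (+ m * + D) * ((+ k - + i) * + binom k i)      ≡⟨ cong (_*_ (+ m * + D)) (binom-absorption k i) ⟩
    (+ m * + D) * (+ suc i * + binom k (suc i))    ≡⟨ regroup′ (+ m) (+ D) (+ suc i) (+ binom k (suc i)) ⟩
    (+ m * + suc i * + D) * + binom k (suc i)      ≡⟨ cong (_* + binom k (suc i)) scale-step ⟩
    + (m ^ suc i ℕ.* suc i !) * + binom k (suc i)  ∎
    where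
    open ≡-Reasoning
    k D : ℕ
    k = a / m
    D = m ^ i ℕ.* i !
    a-step : + a - + (l ℕ.+ i ℕ.* m) ≡ (+ k - + i) * + m
    a-step = begin
      + a - + (l ℕ.+ i ℕ.* m)                   ≡⟨ cong (λ x → + x - + (l ℕ.+ i ℕ.* m)) a≡l+km ⟩
      + (l ℕ.+ k ℕ.* m) - + (l ℕ.+ i ℕ.* m)     ≡⟨ cong₂ _-_ (pos-+* l k m) (pos-+* l i m) ⟩
      (+ l + + k * + m) - (+ l + + i * + m)      ≡⟨ difference (+ l) (+ k) (+ i) (+ m) ⟩
      (+ k - + i) * + m                          ∎
      where
      a≡l+km : a ≡ l ℕ.+ k ℕ.* m
      a≡l+km = trans (m≡m%n+[m/n]*n a m) (cong (ℕ._+ k ℕ.* m) a%m≡l)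
      difference : ∀ l k i m → (l + k * m) - (l + i * m) ≡ (k - i) * m
      difference = solve-∀
    scale-step : + m * + suc i * + D ≡ + (m ^ suc i ℕ.* suc i !)
    scale-step = begin
      + m * + suc i * + D                   ≡⟨ cong (_* + D) (ℤₚ.pos-* m (suc i)) ⟨
      + (m ℕ.* suc i) * + D                 ≡⟨ ℤₚ.pos-* (m ℕ.* suc i) D ⟨
      + (m ℕ.* suc i ℕ.* D)                 ≡⟨ cong +_ (reorder m (suc i) (m ^ i) (i !)) ⟩
      + (m ^ suc i ℕ.* suc i !)             ∎
      where
      reorder : ∀ x y z w → x ℕ.* y ℕ.* (z ℕ.* w) ≡ x ℕ.* z ℕ.* (y ℕ.* w)
      reorder = ℕ-Solver.solve-∀
    regroup : ∀ x m d b → (x * m) * (d * b) ≡ (m * d) * (x * b)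
    regroup = solve-∀
    regroup′ : ∀ m d s b → (m * d) * (s * b) ≡ (m * s * d) * b
    regroup′ = solve-∀

  module ClassMoment {X : Set} (xs : List X) (a : X → ℕ) (w : X → ℤ) (l : ℕ) where

    classWeight : X → ℤ
    classWeight x = δ (a x % m) l * w x

    classMoment : (ℕ → ℤ) → ℤ
    classMoment φ = ∑ xs (λ x → classWeight x * φ (a x))

    classMoment-+ : ∀ φ ψ → classMoment (λ b → φ b + ψ b) ≡ classMoment φ + classMoment ψ
    classMoment-+ φ ψ =
      trans (∑-cong xs λ x → ℤₚ.*-distribˡ-+ (classWeight x) (φ (a x)) (ψ (a x)))
            (∑-+ xs (λ x → classWeight x * φ (a x)) (λ x → classWeight x * ψ (a x)))

    classMoment-* : ∀ c φ → classMoment (λ b → c * φ b) ≡ c * classMoment φ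
    classMoment-* c φ =
      trans (∑-cong xs λ x → swap (classWeight x) c (φ (a x))) (∑-* xs c (λ x → classWeight x * φ (a x)))
      where
      swap : ∀ u c v → u * (c * v) ≡ c * (u * v)
      swap = solve-∀

    classMoment-cong : ∀ {φ ψ} → (∀ b → b % m ≡ l → φ b ≡ ψ b) → classMoment φ ≡ classMoment ψ
    classMoment-cong {φ} {ψ} φ≗ψ = ∑-cong xs termwise
      where
      termwise : ∀ x → classWeight x * φ (a x) ≡ classWeight x * ψ (a x)
      termwise x with a x % m ≟ l
      ... | yes a%m≡l = cong (_*_ (classWeight x)) (φ≗ψ (a x) a%m≡l)
      ... | no  a%m≢l = trans (cong (λ d → d * w x * φ (a x)) (δ-≢ a%m≢l))
                              (sym (cong (λ d → d * w x * ψ (a x)) (δ-≢ a%m≢l)))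

    classMoment-outside : m ≤ l → ∀ φ → classMoment φ ≡ + 0
    classMoment-outside m≤l φ = ∑-zero xs λ x →
      cong (λ d → d * w x * φ (a x)) (δ-≢ (ℕₚ.<⇒≢ (ℕₚ.<-≤-trans (m%n<n (a x) m) m≤l)))

    module _ {r : ℕ} (binomials : ∀ j → j < r → classMoment (λ b → + binom b j) ≡ + 0) where

      classMoment-span : ∀ {s φ} → s ≤ r → BinomialSpan s φ → classMoment φ ≡ + 0
      classMoment-span s≤r (binomial j<s) = binomials _ (ℕₚ.<-≤-trans j<s s≤r)
      classMoment-span s≤r (_⊕_ {φ} {ψ} φ∈ ψ∈) =
        trans (classMoment-+ φ ψ) (cong₂ _+_ (classMoment-span s≤r φ∈) (classMoment-span s≤r ψ∈))
      classMoment-span s≤r (scale {φ} c φ∈) =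
        trans (classMoment-* c φ) (trans (cong (_*_ c) (classMoment-span s≤r φ∈)) (ℤₚ.*-zeroʳ c))
      classMoment-span s≤r (pointwise φ≗ψ φ∈) =
        trans (sym (classMoment-cong λ b _ → φ≗ψ b)) (classMoment-span s≤r φ∈)

      -- On the class, C(b / m, i) is a degree-i polynomial in b, scaled by m^i i!.
      classMoment-quotient-binomials : ∀ i → i < r → classMoment (λ b → + binom (b / m) i) ≡ + 0
      classMoment-quotient-binomials i i<r =
        ℤₚ.*-cancelˡ-≡ (+ D) _ (+ 0) {{D≢0}} (begin
          + D * classMoment (λ b → + binom (b / m) i)
            ≡⟨ classMoment-* (+ D) (λ b → + binom (b / m) i) ⟨
          classMoment (λ b → + D * + binom (b / m) i)
            ≡⟨ classMoment-cong (λ b b%m≡l → falling-on-class b%m≡l i) ⟨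
          classMoment (falling l i)
            ≡⟨ classMoment-span i<r (falling-span l i) ⟩
          + 0
            ≡⟨ ℤₚ.*-zeroʳ (+ D) ⟨
          + D * + 0 ∎)
        where
        open ≡-Reasoning
        D : ℕ
        D = m ^ i ℕ.* i !
        D≢0 : NonZero D
        D≢0 = ℕₚ.m*n≢0 (m ^ i) (i !) {{ℕₚ.m^n≢0 m i}} {{i ℕₚ.!≢0}}

-- Signs and residues modulo 2m

-1^-%2 : ∀ k → -1^ k ≡ -1^ (k % 2)
-1^-%2 zero          = refl
-1^-%2 (suc zero)    = refl
-1^-%2 (suc (suc k)) = begin
  - - -1^ k          ≡⟨ ℤₚ.neg-involutive (-1^ k) ⟩
  -1^ k              ≡⟨ -1^-%2 k ⟩
  -1^ (k % 2)        ≡⟨ cong -1^_ ([m+n]%n≡m%n k 2) ⟨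
  -1^ ((k ℕ.+ 2) % 2) ≡⟨ cong (λ x → -1^ (x % 2)) (ℕₚ.+-comm k 2) ⟩
  -1^ ((2 ℕ.+ k) % 2) ∎
  where open ≡-Reasoning

module Signs (m : ℕ) .{{_ : NonZero m}} where

  instance
    nonZero-2m : NonZero (2 ℕ.* m)
    nonZero-2m = ℕₚ.m*n≢0 2 m

  signed-residue : ∀ {l r} → l < m → r < 2 ℕ.* m → δ (r % m) l * -1^ (r / m) ≡ δ r l - δ r (l ℕ.+ m)
  signed-residue {l} {r} l<m r<2m with r <? m
  ... | yes r<m = begin
    δ (r % m) l * -1^ (r / m)  ≡⟨ cong₂ (λ x y → δ x l * -1^ y) (m<n⇒m%n≡m r<m) (m<n⇒m/n≡0 r<m) ⟩
    δ r l * + 1                ≡⟨ unit (δ r l) ⟩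
    δ r l - + 0                ≡⟨ cong (_-_ (δ r l)) (δ-≢ (ℕₚ.<⇒≢ (ℕₚ.<-≤-trans r<m (ℕₚ.m≤n+m m l)))) ⟨
    δ r l - δ r (l ℕ.+ m)      ∎
    where
    open ≡-Reasoning
    unit : ∀ d → d * + 1 ≡ d - + 0
    unit = solve-∀
  ... | no r≮m = begin
    δ (r % m) l * -1^ (r / m)  ≡⟨ cong₂ (λ x y → δ x l * -1^ y) r%m≡r′ r/m≡1 ⟩
    δ r′ l * - + 1             ≡⟨ negate (δ r′ l) ⟩
    + 0 - δ r′ l               ≡⟨ cong₂ _-_ (δ-≢ (ℕₚ.>⇒≢ (ℕₚ.<-≤-trans l<m m≤r))) δ-upper ⟨
    δ r l - δ r (l ℕ.+ m)      ∎
    where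
    open ≡-Reasoning
    m≤r : m ≤ r
    m≤r = ℕₚ.≮⇒≥ r≮m
    r′ : ℕ
    r′ = r ℕ.∸ m
    r′<m : r′ < m
    r′<m = ℕₚ.m<n+o⇒m∸n<o r m (subst (r <_) (cong (m ℕ.+_) (ℕₚ.+-identityʳ m)) r<2m)
    r%m≡r′ : r % m ≡ r′
    r%m≡r′ = trans (sym (m≤n⇒[n∸m]%m≡n%m m≤r)) (m<n⇒m%n≡m r′<m)
    r/m≡1 : r / m ≡ 1
    r/m≡1 = trans (m/n≡1+[m∸n]/n m≤r) (cong suc (m<n⇒m/n≡0 r′<m))
    δ-upper : δ r (l ℕ.+ m) ≡ δ r′ l
    δ-upper = trans (cong₂ δ (sym (ℕₚ.m+[n∸m]≡n m≤r)) (ℕₚ.+-comm l m)) (δ-+ m r′ l)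
    negate : ∀ d → d * - + 1 ≡ + 0 - d
    negate = solve-∀

  signed-residue-mod2m : ∀ {l} → l < m → ∀ a →
    δ (a % m) l * -1^ (a / m) ≡ δ (mod2m m a) l - δ (mod2m m a) (l ℕ.+ m)
  signed-residue-mod2m {l} l<m a = begin
    δ (a % m) l * -1^ (a / m)     ≡⟨ cong₂ (λ x y → δ x l * y) residue sign ⟩
    δ (r % m) l * -1^ (r / m)     ≡⟨ signed-residue l<m (m%n<n a (2 ℕ.* m)) ⟩
    δ r l - δ r (l ℕ.+ m)         ∎
    where
    open ≡-Reasoning
    r : ℕ
    r = mod2m m a
    residue : a % m ≡ r % m
    residue = sym (m∣n⇒o%n%m≡o%m m (2 ℕ.* m) a (divides 2 refl))
    sign : -1^ (a / m) ≡ -1^ (r / m)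
    sign = trans (-1^-%2 (a / m)) (cong -1^_ (sym (m%[n*o]/o≡m/o%n a 2 m)))

module Exponents (m : ℕ) .{{_ : NonZero m}} {n : ℕ} (st : Fin n → ℕ) where

  open Division m
  open ResidueClass m
  open Signs m

  elements : List (Fin n)
  elements = allFinL n

  toTerm : ℕ → Term
  toTerm a = term (+ 1) (a / m) (a % m)

  terms : List Term
  terms = map (λ x → toTerm (st x)) elements

  genPoly≈⟦terms⟧ : genPoly st ≈ ⟦ terms ⟧
  genPoly≈⟦terms⟧ = ≈-sym (≈-trans (≈-reflexive (foldr-map _ (λ x → toTerm (st x)) [] elements))
                                     (∑ₚ-cong elements λ x → ⟦toTerm⟧ (st x)))
    where
    ⟦toTerm⟧ : ∀ a → ⟦ toTerm a ⟧ₜ ≈ qPow a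
    ⟦toTerm⟧ a = ≈-trans (·-identityˡ _)
      (≈-reflexive (cong qPow (sym (trans (m≡m%n+[m/n]*n a m) (ℕₚ.+-comm (a % m) _)))))

  module _ (l : ℕ) where
    open ClassMoment elements st (λ x → -1^ (st x / m)) l public

  moment-terms : ∀ l j → moment terms l j ≡ classMoment l (λ b → + binom (b / m) j)
  moment-terms l j = trans (foldr-map _ (λ x → toTerm (st x)) (+ 0) elements)
    (∑-cong elements λ x → cong (λ s → δ (st x % m) l * s * + binom (st x / m) j) (ℤₚ.*-identityˡ _))

  classMoment-classSums : ∀ {l} → l < m → ∀ j →
    classMoment l (λ b → + binom b j) ≡ + classSum m st l j - + classSum m st (l ℕ.+ m) j
  classMoment-classSums {l} l<m j = begin
    ∑ elements (λ x → δ (st x % m) l * -1^ (st x / m) * + binom (st x) j)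
      ≡⟨ ∑-cong elements (λ x → termwise (st x)) ⟩
    ∑ elements (λ x → + inClass l (st x) - + inClass (l ℕ.+ m) (st x))
      ≡⟨ ∑-- elements (λ x → + inClass l (st x)) (λ x → + inClass (l ℕ.+ m) (st x)) ⟩
    ∑ elements (λ x → + inClass l (st x)) - ∑ elements (λ x → + inClass (l ℕ.+ m) (st x))
      ≡⟨ cong₂ _-_ (∑-pos elements (λ x → inClass l (st x)))
                   (∑-pos elements (λ x → inClass (l ℕ.+ m) (st x))) ⟨
    + classSum m st l j - + classSum m st (l ℕ.+ m) j ∎
    where
    open ≡-Reasoning
    inClass : ℕ → ℕ → ℕ
    inClass c a = if ⌊ mod2m m a ≟ c ⌋ then a C j else 0
    termwise : ∀ a → δ (a % m) l * -1^ (a / m) * + binom a j ≡ + inClass l a - + inClass (l ℕ.+ m) a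
    termwise a = begin
      δ (a % m) l * -1^ (a / m) * + binom a j   ≡⟨ cong₂ _*_ (signed-residue-mod2m l<m a) (cong +_ (binom≡C a j)) ⟩
      (δ r l - δ r (l ℕ.+ m)) * + (a C j)       ≡⟨ distrib (δ r l) (δ r (l ℕ.+ m)) (+ (a C j)) ⟩
      + (a C j) * δ r l - + (a C j) * δ r (l ℕ.+ m)
        ≡⟨ cong₂ _-_ (pos-if-≟ r l (a C j)) (pos-if-≟ r (l ℕ.+ m) (a C j)) ⟨
      + inClass l a - + inClass (l ℕ.+ m) a     ∎
      where
      r : ℕ
      r = mod2m m a
      distrib : ∀ x y c → (x - y) * c ≡ c * x - c * y
      distrib = solve-∀

  moments-vanish : ∀ r → (∀ l j → l < m → j < r → classSum m st l j ≡ classSum m st (l ℕ.+ m) j) →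
                   ∀ l j → j < r → moment terms l j ≡ + 0
  moments-vanish r agree l j j<r with l <? m
  ... | no  l≮m =
    trans (moment-terms l j) (classMoment-outside l (ℕₚ.≮⇒≥ l≮m) (λ b → + binom (b / m) j))
  ... | yes l<m = trans (moment-terms l j) (classMoment-quotient-binomials l binomials j j<r)
    where
    binomials : ∀ j → j < r → classMoment l (λ b → + binom b j) ≡ + 0
    binomials j j<r = begin
      classMoment l (λ b → + binom b j)       ≡⟨ classMoment-classSums l<m j ⟩
      + classSum m st l j - + upper            ≡⟨ cong (λ c → + c - + upper) (agree l j l<m j<r) ⟩
      + upper - + upper                        ≡⟨ ℤₚ.+-inverseʳ (+ upper) ⟩
      + 0                                      ∎
      where
      open ≡-Reasoning
      upper : ℕ
      upper = classSum m st (l ℕ.+ m) j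

proposition4p7 : (m r : ℕ) → .{{_ : NonZero m}} → (n : ℕ) → (st : Fin n → ℕ) →
    (∀ l j → l < m → j < r → classSum m st l j ≡ classSum m st (l ℕ.+ m) j) →
    ((oneₚ +ₚ qPow m) ^ₚ r) ∣ₚ genPoly st
proposition4p7 m r n st agree =
  ∣ₚ-resp-≈ (A ^ₚ r) genPoly≈⟦terms⟧ (divisible-if-moments-vanish r terms (moments-vanish r agree))
  where
  open Division m
  open Exponents m st
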